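{- Let $a$ be the alternating binary sequence $1010\dots$ of length $n\ge0$. Then $\mathcal{P}_a\cong\mathcal{Q}(n+2)$.
   Context: Two binary sequences of the same length are opposed if there are positions $i,j$ with $b_i>c_i$ and $b_j<c_j$. For $a=a_1\dots a_n$ define sequences of length $n+1$: $a(0)=1a_1\dots a_n$; for $1\le i\le n$, $a(i)=a_1\dots a_{i-1}\,0\,1\,a_{i+1}\dots a_n$; $a(n+1)=a_1\dots a_n0$ (these are distinct). $\mathcal{P}_a$ is the poset on $\{a(0),\dots,a(n+1)\}$ with $a(i)\triangleleft a(j)$ iff $i<j$ and $a(i),a(j)$ are opposed. $\mathcal{Q}(m)$ is $\{1,\dots,m\}$ with $i\triangleleft j$ iff $i\le j-2$. -}

module Defs where

open import Data.Bool using (Bool; true; false; not)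
open import Data.Nat using (ℕ; zero; suc; _+_; _≤_)
open import Data.Fin using (Fin; zero; suc; toℕ; _<_)
open import Data.Vec using (Vec; []; _∷_; lookup)
open import Data.Product using (Σ; ∃; ∃-syntax; _×_)
open import Relation.Binary.PropositionalEquality using (_≡_)
open import Function.Bundles using (_⇔_)

-- Binary sequences of length n: Vec Bool n  (true = 1, false = 0).

Opposed : ∀ {m} → Vec Bool m → Vec Bool m → Set
Opposed b c = ∃[ i ] ∃[ j ] ((lookup b i ≡ true × lookup c i ≡ false)
                           × (lookup b j ≡ false × lookup c j ≡ true))

-- ext a i = a(i), for i ∈ {0, …, n+1} (represented by Fin (n + 2)):
--   a(0) = 1 a₁…aₙ ; a(i) = a₁…a_{i-1} 0 1 a_{i+1}…aₙ (1 ≤ i ≤ n) ; a(n+1) = a₁…aₙ 0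
ext : ∀ {n} → Vec Bool n → Fin (suc (suc n)) → Vec Bool (suc n)
ext a zero = true ∷ a
ext [] (suc zero) = false ∷ []
ext (x ∷ xs) (suc zero) = false ∷ true ∷ xs
ext (x ∷ xs) (suc (suc k)) = x ∷ ext xs (suc k)

InP : ∀ {n} → Vec Bool n → Vec Bool (suc n) → Set
InP a s = ∃[ i ] (s ≡ ext a i)

PRel : ∀ {n} → Vec Bool n → Vec Bool (suc n) → Vec Bool (suc n) → Set
PRel a s t = ∃[ i ] ∃[ j ] (i < j × s ≡ ext a i × t ≡ ext a j × Opposed s t)

-- 𝒬(m): {1,…,m} represented by Fin m (k ↦ k+1); i ◁ j iff i ≤ j - 2.
QRel : ∀ {m} → Fin m → Fin m → Set
QRel i j = toℕ i + 2 ≤ toℕ j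

altFrom : Bool → (n : ℕ) → Vec Bool n
altFrom b zero = []
altFrom b (suc n) = b ∷ altFrom (not b) n

alt : (n : ℕ) → Vec Bool n
alt = altFrom true

IsoQP : ∀ {n} → Vec Bool n → Set
IsoQP {n} a =
  Σ (Fin (suc (suc n)) → Vec Bool (suc n)) λ f →
      (∀ k l → f k ≡ f l → k ≡ l)
    × (∀ k → InP a (f k))
    × (∀ s → InP a s → ∃[ k ] (f k ≡ s))
    × (∀ k l → (QRel k l ⇔ PRel a (f k) (f l)))

-- For n ≥ 2 the alternating sequence a = 1 0 a′ satisfies a(i+2) = 1 0 a′(i), and opposedness
-- is insensitive to a common prefix, so 𝒫_a contains a copy of 𝒫_a′ shifted by two. The
-- isomorphism from 𝒬(n+2) swaps consecutive pairs of points: the first point of 𝒬 goes to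
-- a(1) = 0 1 0 …, which is opposed to every later a(i), and the second to a(0) = 1 1 0 …,
-- which is opposed to every later a(i) except a(3) = 1 0 0 …, a sequence it dominates.
-- The cases n ≤ 1 are finite checks.
module Submission where

open import Defs
open import Data.Bool using (Bool; true; false)
import Data.Bool.Properties as Bool
open import Data.Nat using (ℕ; zero; suc; z≤n; s≤s; s≤s⁻¹)
import Data.Nat as ℕ
open import Data.Fin using (Fin; zero; suc; toℕ; _<_)
open import Data.Fin.Properties using (any?; all?; _<?_)
open import Data.Vec using (Vec; []; _∷_; lookup)
open import Data.Vec.Properties using (∷-injectiveʳ)
open import Data.Product using (∃-syntax; _×_; _,_)
open import Data.Product.Function.NonDependent.Propositional using (_×-⇔_)
open import Data.Empty using (⊥-elim)
open import Function using (_∘_; const)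
open import Function.Bundles using (_⇔_; mk⇔; Equivalence)
open import Function.Construct.Composition using (_⇔-∘_)
open import Function.Construct.Symmetry using (⇔-sym)
open import Function.Properties.Equivalence using (⇔-setoid)
open import Level using (0ℓ)
import Relation.Binary.Reasoning.Setoid as SetoidReasoning
open import Relation.Nullary using (¬_; Dec; yes; no)
open import Relation.Nullary.Decidable using (_×-dec_; from-yes)
open import Relation.Binary.PropositionalEquality
  using (_≡_; _≢_; refl; sym; trans; cong; module ≡-Reasoning)

private
  module ⇔-Reasoning = SetoidReasoning (⇔-setoid 0ℓ)

  variable
    m n : ℕ

_⇔-dec_ : ∀ {a b} {A : Set a} {B : Set b} → Dec A → Dec B → Dec (A ⇔ B)
yes a ⇔-dec yes b = yes (mk⇔ (const b) (const a))
yes a ⇔-dec no ¬b = no λ a⇔b → ¬b (Equivalence.to a⇔b a)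
no ¬a ⇔-dec yes b = no λ a⇔b → ¬a (Equivalence.from a⇔b b)
no ¬a ⇔-dec no ¬b = yes (mk⇔ (⊥-elim ∘ ¬a) (⊥-elim ∘ ¬b))

QRel? : (k l : Fin m) → Dec (QRel k l)
QRel? k l = toℕ k ℕ.+ 2 ℕ.≤? toℕ l

Opposed? : (b c : Vec Bool m) → Dec (Opposed b c)
Opposed? b c = any? λ i → any? λ j →
  (lookup b i Bool.≟ true ×-dec lookup c i Bool.≟ false) ×-dec
  (lookup b j Bool.≟ false ×-dec lookup c j Bool.≟ true)

Opposed-∷⇔ : ∀ x (s t : Vec Bool m) → Opposed (x ∷ s) (x ∷ t) ⇔ Opposed s t
Opposed-∷⇔ x s t = mk⇔ tail (λ { (i , j , o) → suc i , suc j , o })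
  where
  tail : Opposed (x ∷ s) (x ∷ t) → Opposed s t
  tail (zero  , _     , (refl , ()) , _)
  tail (suc i , zero  , _ , (refl , ()))
  tail (suc i , suc j , o) = i , j , o

¬Opposed-true∷false∷ : (s : Vec Bool m) → ¬ Opposed (true ∷ s) (false ∷ s)
¬Opposed-true∷false∷ s (_ , zero  , _ , (() , _))
¬Opposed-true∷false∷ s (_ , suc j , _ , (sⱼ≡false , sⱼ≡true))
  with trans (sym sⱼ≡false) sⱼ≡true
... | ()

ext-zero≢ext-suc : (a : Vec Bool n) (k : Fin (suc n)) → ext a zero ≢ ext a (suc k)
ext-zero≢ext-suc []           zero     ()
ext-zero≢ext-suc (x ∷ a)      zero     ()
ext-zero≢ext-suc (false ∷ a)  (suc k)  ()
ext-zero≢ext-suc (true ∷ a)   (suc k)  e = ext-zero≢ext-suc a k (∷-injectiveʳ e)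

ext-one≢ext-suc-suc : (a : Vec Bool n) (k : Fin n) → ext a (suc zero) ≢ ext a (suc (suc k))
ext-one≢ext-suc-suc (true ∷ a)  k ()
ext-one≢ext-suc-suc (false ∷ a) k e = ext-zero≢ext-suc a k (∷-injectiveʳ e)

ext-injective : (a : Vec Bool n) {i j : Fin (suc (suc n))} → ext a i ≡ ext a j → i ≡ j
ext-injective a {zero}  {zero}  e = refl
ext-injective a {zero}  {suc j} e = ⊥-elim (ext-zero≢ext-suc a j e)
ext-injective a {suc i} {zero}  e = ⊥-elim (ext-zero≢ext-suc a i (sym e))
ext-injective a {suc zero} {suc zero} e = refl
ext-injective a {suc zero} {suc (suc j)} e = ⊥-elim (ext-one≢ext-suc-suc a j e)
ext-injective a {suc (suc i)} {suc zero} e = ⊥-elim (ext-one≢ext-suc-suc a i (sym e))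
ext-injective (x ∷ a) {suc (suc i)} {suc (suc j)} e =
  cong suc (ext-injective a (∷-injectiveʳ e))

PRelAt : Vec Bool n → Fin (suc (suc n)) → Fin (suc (suc n)) → Set
PRelAt a i j = i < j × Opposed (ext a i) (ext a j)

PRel-ext⇔PRelAt : (a : Vec Bool n) (i j : Fin (suc (suc n))) →
                  PRel a (ext a i) (ext a j) ⇔ PRelAt a i j
PRel-ext⇔PRelAt a i j = mk⇔ to (λ (i<j , o) → i , j , i<j , refl , refl , o)
  where
  to : PRel a (ext a i) (ext a j) → PRelAt a i j
  to (i′ , j′ , i′<j′ , eᵢ , eⱼ , o) with ext-injective a eᵢ | ext-injective a eⱼ
  ... | refl | refl = i′<j′ , o

isoQP-via-involution : (a : Vec Bool n) (π : Fin (suc (suc n)) → Fin (suc (suc n))) →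
                       (∀ k → π (π k) ≡ k) →
                       (∀ k l → QRel k l ⇔ PRelAt a (π k) (π l)) →
                       IsoQP a
isoQP-via-involution a π π∘π≡id order =
  ext a ∘ π , injective , (λ k → π k , refl) , surjective ,
  λ k l → ⇔-sym (PRel-ext⇔PRelAt a (π k) (π l)) ⇔-∘ order k l
  where
  open ≡-Reasoning
  injective : ∀ k l → ext a (π k) ≡ ext a (π l) → k ≡ l
  injective k l e = begin
    k         ≡⟨ sym (π∘π≡id k) ⟩
    π (π k)   ≡⟨ cong π (ext-injective a e) ⟩
    π (π l)   ≡⟨ π∘π≡id l ⟩
    l         ∎
  surjective : ∀ s → InP a s → ∃[ k ] (ext a (π k) ≡ s)
  surjective s (i , refl) = π i , cong (ext a) (π∘π≡id i)

swapPairs : Fin m → Fin m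
swapPairs {suc zero}    zero          = zero
swapPairs {suc (suc m)} zero          = suc zero
swapPairs {suc (suc m)} (suc zero)    = zero
swapPairs {suc (suc m)} (suc (suc k)) = suc (suc (swapPairs k))

swapPairs-involutive : (k : Fin m) → swapPairs (swapPairs k) ≡ k
swapPairs-involutive {suc zero}    zero          = refl
swapPairs-involutive {suc (suc m)} zero          = refl
swapPairs-involutive {suc (suc m)} (suc zero)    = refl
swapPairs-involutive {suc (suc m)} (suc (suc k)) =
  cong (λ j → suc (suc j)) (swapPairs-involutive k)

QRel⇔PRelAt? : (a : Vec Bool n) →
               Dec (∀ k l → QRel k l ⇔ PRelAt a (swapPairs k) (swapPairs l))
QRel⇔PRelAt? a = all? λ k → all? λ l →
  QRel? k l ⇔-dec
  (swapPairs k <? swapPairs l ×-dec Opposed? (ext a (swapPairs k)) (ext a (swapPairs l)))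

ext-alt-suc-suc : ∀ n (i : Fin (suc (suc n))) →
                  ext (alt (suc (suc n))) (suc (suc i)) ≡ true ∷ false ∷ ext (alt n) i
ext-alt-suc-suc n zero    = refl
ext-alt-suc-suc n (suc i) = refl

ext-alt-one : ∀ n → ext (alt n) (suc zero) ≡ false ∷ alt n
ext-alt-one zero    = refl
ext-alt-one (suc n) = refl

head-ext-alt-suc-suc : ∀ n (i : Fin n) → lookup (ext (alt n) (suc (suc i))) zero ≡ true
head-ext-alt-suc-suc (suc n) i = refl

PRelAt-alt-suc-suc : ∀ n (i j : Fin (suc (suc n))) →
                     PRelAt (alt (suc (suc n))) (suc (suc i)) (suc (suc j)) ⇔ PRelAt (alt n) i j
PRelAt-alt-suc-suc n i j rewrite ext-alt-suc-suc n i | ext-alt-suc-suc n j =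
  mk⇔ (s≤s⁻¹ ∘ s≤s⁻¹) (s≤s ∘ s≤s) ×-⇔
  (Opposed-∷⇔ false _ _ ⇔-∘ Opposed-∷⇔ true _ _)

QRel-suc⇔ : (k l : Fin m) → QRel (suc k) (suc l) ⇔ QRel k l
QRel-suc⇔ k l = mk⇔ s≤s⁻¹ s≤s

opposed-alt-one-suc-suc : ∀ n (i : Fin (suc (suc n))) →
                          Opposed (ext (alt (suc (suc n))) (suc zero))
                                  (ext (alt (suc (suc n))) (suc (suc i)))
opposed-alt-one-suc-suc n i rewrite ext-alt-suc-suc n i =
  suc zero , zero , (refl , refl) , (refl , refl)

¬opposed-alt-zero-three : ∀ n → ¬ Opposed (ext (alt (suc (suc n))) zero)
                                            (ext (alt (suc (suc n))) (suc (suc (suc zero))))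
¬opposed-alt-zero-three n o rewrite ext-alt-one n =
  ¬Opposed-true∷false∷ _ (Equivalence.to (Opposed-∷⇔ true _ _) o)

QRel⇔PRelAt-alt : ∀ n (k l : Fin (suc (suc n))) →
                  QRel k l ⇔ PRelAt (alt n) (swapPairs k) (swapPairs l)
QRel⇔PRelAt-alt zero          = from-yes (QRel⇔PRelAt? (alt zero))
QRel⇔PRelAt-alt (suc zero)    = from-yes (QRel⇔PRelAt? (alt (suc zero)))
QRel⇔PRelAt-alt (suc (suc n)) zero zero = mk⇔ (λ ()) (λ { (s≤s () , _) })
QRel⇔PRelAt-alt (suc (suc n)) zero (suc zero) = mk⇔ (λ { (s≤s ()) }) (λ { (() , _) })
QRel⇔PRelAt-alt (suc (suc n)) zero (suc (suc l)) =
  mk⇔ (const (s≤s (s≤s z≤n) , opposed-alt-one-suc-suc n (swapPairs l)))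
      (const (s≤s (s≤s z≤n)))
QRel⇔PRelAt-alt (suc (suc n)) (suc zero) zero =
  mk⇔ (λ ()) (λ (_ , o) → ⊥-elim (¬Opposed-true∷false∷ _ o))
QRel⇔PRelAt-alt (suc (suc n)) (suc zero) (suc zero) = mk⇔ (λ { (s≤s ()) }) (λ { (() , _) })
QRel⇔PRelAt-alt (suc (suc n)) (suc zero) (suc (suc zero)) =
  mk⇔ (λ { (s≤s (s≤s ())) }) (λ (_ , o) → ⊥-elim (¬opposed-alt-zero-three n o))
QRel⇔PRelAt-alt (suc (suc n)) (suc zero) (suc (suc (suc zero))) =
  mk⇔ (const (s≤s z≤n , suc zero , suc (suc zero) , (refl , refl) , (refl , refl)))
      (const (s≤s (s≤s (s≤s z≤n))))
QRel⇔PRelAt-alt (suc (suc n)) (suc zero) (suc (suc (suc (suc m)))) =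
  mk⇔ (const (s≤s z≤n , suc zero , suc (suc zero) , (refl , refl) ,
              (refl , head-ext-alt-suc-suc n (swapPairs m))))
      (const (s≤s (s≤s (s≤s z≤n))))
QRel⇔PRelAt-alt (suc (suc n)) (suc (suc k)) zero = mk⇔ (λ ()) (λ { (s≤s () , _) })
QRel⇔PRelAt-alt (suc (suc n)) (suc (suc k)) (suc zero) =
  mk⇔ (λ { (s≤s ()) }) (λ { (() , _) })
QRel⇔PRelAt-alt (suc (suc n)) (suc (suc k)) (suc (suc l)) = begin
  QRel (suc (suc k)) (suc (suc l))            ≈⟨ QRel-suc⇔ (suc k) (suc l) ⟩
  QRel (suc k) (suc l)                        ≈⟨ QRel-suc⇔ k l ⟩
  QRel k l                                    ≈⟨ QRel⇔PRelAt-alt n k l ⟩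
  PRelAt (alt n) (swapPairs k) (swapPairs l)
    ≈⟨ PRelAt-alt-suc-suc n (swapPairs k) (swapPairs l) ⟨
  PRelAt (alt (suc (suc n))) (suc (suc (swapPairs k))) (suc (suc (swapPairs l))) ∎
  where open ⇔-Reasoning

proposition5p4 : (n : ℕ) → IsoQP (alt n)
proposition5p4 n = isoQP-via-involution (alt n) swapPairs swapPairs-involutive (QRel⇔PRelAt-alt n)
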